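{- Let $\mathcal C$ be a tidy LD category, $u\in\mathfrak Z$, $\vec A\in\mathcal C^{|u|}$, and $i$ an identity morphism of an $\odot$-product. For every atomic morphism $h$ with target $H^i_u(\vec A)$, the composite $\kappa^i_u(\vec A)\circ h$ is $\mathrm{Id}^\odot$-analysable.
   Context: $\mathcal C$ is a unitless LD category: bifunctors $\otimes,\odot$ (no units), natural isomorphisms $\alpha_{A,B,C}:A\otimes(B\otimes C)\to(A\otimes B)\otimes C$, $\bar\alpha_{A,B,C}:A\odot(B\odot C)\to(A\odot B)\odot C$, natural transformations $\delta^l_{A,B,C}:A\otimes(B\odot C)\to(A\otimes B)\odot C$, $\delta^r_{A,B,C}:(A\odot B)\otimes C\to A\odot(B\otimes C)$, satisfying (objects denote identities): (P1) $\alpha_{A\otimes B,C,D}\circ\alpha_{A,B,C\otimes D}=(\alpha_{A,B,C}\otimes D)\circ\alpha_{A,B\otimes C,D}\circ(A\otimes\alpha_{B,C,D})$; (P2) $\delta^l_{A\otimes B,C,D}\circ\alpha_{A,B,C\odot D}=(\alpha_{A,B,C}\odot D)\circ\delta^l_{A,B\otimes C,D}\circ(A\otimes\delta^l_{B,C,D})$; (P3) $\delta^l_{A,B,C\otimes D}\circ(A\otimes\delta^r_{B,C,D})=\delta^r_{A\otimes B,C,D}\circ(\delta^l_{A,B,C}\otimes D)\circ\alpha_{A,B\odot C,D}$; (P4) $\bar\alpha_{A\otimes B,C,D}\circ\delta^l_{A,B,C\odot D}=(\delta^l_{A,B,C}\odot D)\circ\delta^l_{A,B\odot C,D}\circ(A\otimes\bar\alpha_{B,C,D})$;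 (P5) $(A\odot\alpha_{B,C,D})\circ\delta^r_{A,B,C\otimes D}=\delta^r_{A,B\otimes C,D}\circ(\delta^r_{A,B,C}\otimes D)\circ\alpha_{A\odot B,C,D}$; (P6) $(\delta^r_{A,B,C}\odot D)\circ\delta^l_{A\odot B,C,D}=\bar\alpha_{A,B\otimes C,D}\circ(A\odot\delta^l_{B,C,D})\circ\delta^r_{A,B,C\odot D}$; (P7) $\delta^r_{A\odot B,C,D}\circ(\bar\alpha_{A,B,C}\otimes D)=\bar\alpha_{A,B,C\otimes D}\circ(A\odot\delta^r_{B,C,D})\circ\delta^r_{A,B\odot C,D}$; (P8) $\bar\alpha_{A\odot B,C,D}\circ\bar\alpha_{A,B,C\odot D}=(\bar\alpha_{A,B,C}\odot D)\circ\bar\alpha_{A,B\odot C,D}\circ(A\odot\bar\alpha_{B,C,D})$. Tidy: $A_1\otimes A_2=B_1\otimes B_2\Rightarrow A_i=B_i$, same for $\odot$, and $A_1\otimes A_2\ne B_1\odot B_2$. Atomic morphisms: smallest class containing components of $\alpha^{\pm1},\bar\alpha^{\pm1},\delta^l,\delta^r$ and closed under tensoring ($\otimes$ or $\odot$, either side) with identities. $\mathrm{Id}^\odot$ = identities of $\odot$-products (objects $A_1\odot A_2$). $\mathfrak Z$ = free monoid on letters $\bar\alpha,\bar\alpha^{ -1},\delta^l,\delta^r$. For $f:H\to L\odot R$ and $u\in\mathfrak Z$: $H^f_\emptyset=H,L^f_\emptyset=L,R^f_\emptyset=R$; $H^f_{\bar\alpha u}(\vec A)=A_1\odot H^f_u(\vec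 A_{\ge2})$, $L^f_{\bar\alpha u}(\vec A)=A_1\odot L^f_u(\vec A_{\ge2})$, $R^f_{\bar\alpha u}(\vec A)=R^f_u(\vec A_{\ge2})$; $H^f_{\bar\alpha^{ -1}u}(\vec A)=H^f_u(\vec A_{\le|u|})\odot A_{|u|+1}$, $L^f_{\bar\alpha^{ -1}u}(\vec A)=L^f_u(\vec A_{\le|u|})$, $R^f_{\bar\alpha^{ -1}u}(\vec A)=R^f_u(\vec A_{\le|u|})\odot A_{|u|+1}$; $H^f_{\delta^lu}(\vec A)=A_1\otimes H^f_u(\vec A_{\ge2})$, $L^f_{\delta^lu}(\vec A)=A_1\otimes L^f_u(\vec A_{\ge2})$, $R^f_{\delta^lu}(\vec A)=R^f_u(\vec A_{\ge2})$; $H^f_{\delta^ru}(\vec A)=H^f_u(\vec A_{\le|u|})\otimes A_{|u|+1}$, $L^f_{\delta^ru}(\vec A)=L^f_u(\vec A_{\le|u|})$, $R^f_{\delta^ru}(\vec A)=R^f_u(\vec A_{\le|u|})\otimes A_{|u|+1}$ (where $\vec A_{\ge k}=(A_k,\dots)$, $\vec A_{\le k}=(A_1,\dots,A_k)$). $\kappa^f_\emptyset=f$, $\kappa^f_{\bar\alpha u}=\bar\alpha\circ(\mathrm{id}\odot\kappa^f_u)$, $\kappa^f_{\bar\alpha^{ -1}u}=\bar\alpha^{ -1}\circ(\kappa^f_u\odot\mathrm{id})$, $\kappa^f_{\delta^lu}=\delta^l\circ(\mathrm{id}\otimes\kappa^f_u)$, $\kappa^f_{\delta^ru}=\delta^r\circ(\kappa^f_u\otimes\mathrm{id})$.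 For a set $\mathfrak f$ of morphisms with $\odot$-product targets, $g$ is $\mathfrak f$-analysable if $g=(g'\odot g'')\circ\kappa^f_v(\vec B)$ for morphisms $g',g''$, $f\in\mathfrak f$, $v\in\mathfrak Z$, $\vec B\in\mathcal C^{|v|}$. -}

module Defs where

open import Level using (Level; _⊔_) renaming (suc to lsuc)
open import Data.Nat using (ℕ; suc)
open import Data.List using (List; []; _∷_; length)
open import Data.Vec using (Vec; []; _∷_; init; last)
open import Data.Product using (Σ; _,_; _×_; ∃-syntax)
open import Relation.Binary.PropositionalEquality using (_≡_)
open import Relation.Nullary using (¬_)


-- A unitless LD (linearly distributive) category.  Morphism equality is
-- propositional equality.  Composition is written g ∘ f ("g after f").
record LDCat (o h : Level) : Set (lsuc (o ⊔ h)) where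
  infixr 9 _∘_
  infixr 10 _⊗₀_ _⊙₀_ _⊗₁_ _⊙₁_
  field
    Obj : Set o
    Hom : Obj → Obj → Set h
    id  : ∀ {A} → Hom A A
    _∘_ : ∀ {A B C} → Hom B C → Hom A B → Hom A C
    assoc : ∀ {A B C D} (f : Hom C D) (g : Hom B C) (k : Hom A B) →
            (f ∘ g) ∘ k ≡ f ∘ (g ∘ k)
    identityˡ : ∀ {A B} (f : Hom A B) → id ∘ f ≡ f
    identityʳ : ∀ {A B} (f : Hom A B) → f ∘ id ≡ f

    _⊗₀_ : Obj → Obj → Obj
    _⊗₁_ : ∀ {A B C D} → Hom A B → Hom C D → Hom (A ⊗₀ C) (B ⊗₀ D)
    ⊗-id : ∀ {A B} → id {A} ⊗₁ id {B} ≡ id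
    ⊗-∘  : ∀ {A B C A' B' C'} (f : Hom B C) (g : Hom A B) (f' : Hom B' C') (g' : Hom A' B') →
           (f ∘ g) ⊗₁ (f' ∘ g') ≡ (f ⊗₁ f') ∘ (g ⊗₁ g')
    _⊙₀_ : Obj → Obj → Obj
    _⊙₁_ : ∀ {A B C D} → Hom A B → Hom C D → Hom (A ⊙₀ C) (B ⊙₀ D)
    ⊙-id : ∀ {A B} → id {A} ⊙₁ id {B} ≡ id
    ⊙-∘  : ∀ {A B C A' B' C'} (f : Hom B C) (g : Hom A B) (f' : Hom B' C') (g' : Hom A' B') →
           (f ∘ g) ⊙₁ (f' ∘ g') ≡ (f ⊙₁ f') ∘ (g ⊙₁ g')

    α   : ∀ A B C → Hom (A ⊗₀ (B ⊗₀ C)) ((A ⊗₀ B) ⊗₀ C)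
    α⁻¹ : ∀ A B C → Hom ((A ⊗₀ B) ⊗₀ C) (A ⊗₀ (B ⊗₀ C))
    α-iso₁ : ∀ A B C → α A B C ∘ α⁻¹ A B C ≡ id
    α-iso₂ : ∀ A B C → α⁻¹ A B C ∘ α A B C ≡ id
    α-nat : ∀ {A A' B B' C C'} (f : Hom A A') (g : Hom B B') (k : Hom C C') →
            α A' B' C' ∘ (f ⊗₁ (g ⊗₁ k)) ≡ ((f ⊗₁ g) ⊗₁ k) ∘ α A B C
    ᾱ   : ∀ A B C → Hom (A ⊙₀ (B ⊙₀ C)) ((A ⊙₀ B) ⊙₀ C)
    ᾱ⁻¹ : ∀ A B C → Hom ((A ⊙₀ B) ⊙₀ C) (A ⊙₀ (B ⊙₀ C))
    ᾱ-iso₁ : ∀ A B C → ᾱ A B C ∘ ᾱ⁻¹ A B C ≡ id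
    ᾱ-iso₂ : ∀ A B C → ᾱ⁻¹ A B C ∘ ᾱ A B C ≡ id
    ᾱ-nat : ∀ {A A' B B' C C'} (f : Hom A A') (g : Hom B B') (k : Hom C C') →
            ᾱ A' B' C' ∘ (f ⊙₁ (g ⊙₁ k)) ≡ ((f ⊙₁ g) ⊙₁ k) ∘ ᾱ A B C

    δˡ : ∀ A B C → Hom (A ⊗₀ (B ⊙₀ C)) ((A ⊗₀ B) ⊙₀ C)
    δˡ-nat : ∀ {A A' B B' C C'} (f : Hom A A') (g : Hom B B') (k : Hom C C') →
             δˡ A' B' C' ∘ (f ⊗₁ (g ⊙₁ k)) ≡ ((f ⊗₁ g) ⊙₁ k) ∘ δˡ A B C
    δʳ : ∀ A B C → Hom ((A ⊙₀ B) ⊗₀ C) (A ⊙₀ (B ⊗₀ C))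
    δʳ-nat : ∀ {A A' B B' C C'} (f : Hom A A') (g : Hom B B') (k : Hom C C') →
             δʳ A' B' C' ∘ ((f ⊙₁ g) ⊗₁ k) ≡ (f ⊙₁ (g ⊗₁ k)) ∘ δʳ A B C

    P1 : ∀ A B C D → α (A ⊗₀ B) C D ∘ α A B (C ⊗₀ D)
                   ≡ (α A B C ⊗₁ id) ∘ α A (B ⊗₀ C) D ∘ (id ⊗₁ α B C D)
    P2 : ∀ A B C D → δˡ (A ⊗₀ B) C D ∘ α A B (C ⊙₀ D)
                   ≡ (α A B C ⊙₁ id) ∘ δˡ A (B ⊗₀ C) D ∘ (id ⊗₁ δˡ B C D)
    P3 : ∀ A B C D → δˡ A B (C ⊗₀ D) ∘ (id ⊗₁ δʳ B C D)
                   ≡ δʳ (A ⊗₀ B) C D ∘ (δˡ A B C ⊗₁ id) ∘ α A (B ⊙₀ C) D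
    P4 : ∀ A B C D → ᾱ (A ⊗₀ B) C D ∘ δˡ A B (C ⊙₀ D)
                   ≡ (δˡ A B C ⊙₁ id) ∘ δˡ A (B ⊙₀ C) D ∘ (id ⊗₁ ᾱ B C D)
    P5 : ∀ A B C D → (id ⊙₁ α B C D) ∘ δʳ A B (C ⊗₀ D)
                   ≡ δʳ A (B ⊗₀ C) D ∘ (δʳ A B C ⊗₁ id) ∘ α (A ⊙₀ B) C D
    P6 : ∀ A B C D → (δʳ A B C ⊙₁ id) ∘ δˡ (A ⊙₀ B) C D
                   ≡ ᾱ A (B ⊗₀ C) D ∘ (id ⊙₁ δˡ B C D) ∘ δʳ A B (C ⊙₀ D)
    P7 : ∀ A B C D → δʳ (A ⊙₀ B) C D ∘ (ᾱ A B C ⊗₁ id)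
                   ≡ ᾱ A B (C ⊗₀ D) ∘ (id ⊙₁ δʳ B C D) ∘ δʳ A (B ⊙₀ C) D
    P8 : ∀ A B C D → ᾱ (A ⊙₀ B) C D ∘ ᾱ A B (C ⊙₀ D)
                   ≡ (ᾱ A B C ⊙₁ id) ∘ ᾱ A (B ⊙₀ C) D ∘ (id ⊙₁ ᾱ B C D)

module _ {o h : Level} (𝒞 : LDCat o h) where
  open LDCat 𝒞

  record Tidy : Set o where
    field
      ⊗-inj : ∀ {A₁ A₂ B₁ B₂} → A₁ ⊗₀ A₂ ≡ B₁ ⊗₀ B₂ → (A₁ ≡ B₁) × (A₂ ≡ B₂)
      ⊙-inj : ∀ {A₁ A₂ B₁ B₂} → A₁ ⊙₀ A₂ ≡ B₁ ⊙₀ B₂ → (A₁ ≡ B₁) × (A₂ ≡ B₂)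
      ⊗≢⊙   : ∀ {A₁ A₂ B₁ B₂} → ¬ (A₁ ⊗₀ A₂ ≡ B₁ ⊙₀ B₂)

  data Atomic : ∀ {X Y} → Hom X Y → Set (o ⊔ h) where
    at-α   : ∀ A B C → Atomic (α A B C)
    at-α⁻¹ : ∀ A B C → Atomic (α⁻¹ A B C)
    at-ᾱ   : ∀ A B C → Atomic (ᾱ A B C)
    at-ᾱ⁻¹ : ∀ A B C → Atomic (ᾱ⁻¹ A B C)
    at-δˡ  : ∀ A B C → Atomic (δˡ A B C)
    at-δʳ  : ∀ A B C → Atomic (δʳ A B C)
    at-⊗ˡ  : ∀ {X Y} {f : Hom X Y} (C : Obj) → Atomic f → Atomic (f ⊗₁ id {C})
    at-⊗ʳ  : ∀ {X Y} {f : Hom X Y} (C : Obj) → Atomic f → Atomic (id {C} ⊗₁ f)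
    at-⊙ˡ  : ∀ {X Y} {f : Hom X Y} (C : Obj) → Atomic f → Atomic (f ⊙₁ id {C})
    at-⊙ʳ  : ∀ {X Y} {f : Hom X Y} (C : Obj) → Atomic f → Atomic (id {C} ⊙₁ f)

data Letter : Set where
  ᾱ-l ᾱ⁻¹-l δˡ-l δʳ-l : Letter

𝔷 : Set
𝔷 = List Letter

module _ {o h : Level} (𝒞 : LDCat o h) where
  open LDCat 𝒞

  -- H^f_u, L^f_u, R^f_u for f : H₀ → L₀ ⊙ R₀ (they depend on f only through H₀, L₀, R₀)
  Hᶠ : Obj → (u : 𝔷) → Vec Obj (length u) → Obj
  Hᶠ H₀ []           []       = H₀
  Hᶠ H₀ (ᾱ-l   ∷ u) (A ∷ As) = A ⊙₀ Hᶠ H₀ u As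
  Hᶠ H₀ (ᾱ⁻¹-l ∷ u) As       = Hᶠ H₀ u (init As) ⊙₀ last As
  Hᶠ H₀ (δˡ-l  ∷ u) (A ∷ As) = A ⊗₀ Hᶠ H₀ u As
  Hᶠ H₀ (δʳ-l  ∷ u) As       = Hᶠ H₀ u (init As) ⊗₀ last As

  Lᶠ : Obj → (u : 𝔷) → Vec Obj (length u) → Obj
  Lᶠ L₀ []           []       = L₀
  Lᶠ L₀ (ᾱ-l   ∷ u) (A ∷ As) = A ⊙₀ Lᶠ L₀ u As
  Lᶠ L₀ (ᾱ⁻¹-l ∷ u) As       = Lᶠ L₀ u (init As)
  Lᶠ L₀ (δˡ-l  ∷ u) (A ∷ As) = A ⊗₀ Lᶠ L₀ u As
  Lᶠ L₀ (δʳ-l  ∷ u) As       = Lᶠ L₀ u (init As)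

  Rᶠ : Obj → (u : 𝔷) → Vec Obj (length u) → Obj
  Rᶠ R₀ []           []       = R₀
  Rᶠ R₀ (ᾱ-l   ∷ u) (A ∷ As) = Rᶠ R₀ u As
  Rᶠ R₀ (ᾱ⁻¹-l ∷ u) As       = Rᶠ R₀ u (init As) ⊙₀ last As
  Rᶠ R₀ (δˡ-l  ∷ u) (A ∷ As) = Rᶠ R₀ u As
  Rᶠ R₀ (δʳ-l  ∷ u) As       = Rᶠ R₀ u (init As) ⊗₀ last As

  κ : ∀ {H₀ L₀ R₀} → Hom H₀ (L₀ ⊙₀ R₀) → (u : 𝔷) (As : Vec Obj (length u)) →
      Hom (Hᶠ H₀ u As) (Lᶠ L₀ u As ⊙₀ Rᶠ R₀ u As)
  κ f []           []       = f
  κ {L₀ = L₀} {R₀} f (ᾱ-l ∷ u) (A ∷ As) =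
    ᾱ A (Lᶠ L₀ u As) (Rᶠ R₀ u As) ∘ (id ⊙₁ κ f u As)
  κ {L₀ = L₀} {R₀} f (ᾱ⁻¹-l ∷ u) As =
    ᾱ⁻¹ (Lᶠ L₀ u (init As)) (Rᶠ R₀ u (init As)) (last As) ∘ (κ f u (init As) ⊙₁ id)
  κ {L₀ = L₀} {R₀} f (δˡ-l ∷ u) (A ∷ As) =
    δˡ A (Lᶠ L₀ u As) (Rᶠ R₀ u As) ∘ (id ⊗₁ κ f u As)
  κ {L₀ = L₀} {R₀} f (δʳ-l ∷ u) As =
    δʳ (Lᶠ L₀ u (init As)) (Rᶠ R₀ u (init As)) (last As) ∘ (κ f u (init As) ⊗₁ id)

  Arrow : Set (o ⊔ h)
  Arrow = Σ Obj λ X → Σ Obj λ Y → Hom X Y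

  MorClass : (ℓ : Level) → Set (o ⊔ h ⊔ Level.suc ℓ)
  MorClass ℓ = ∀ {H₀ L₀ R₀} → Hom H₀ (L₀ ⊙₀ R₀) → Set ℓ

  Id⊙ : MorClass (o ⊔ h)
  Id⊙ {H₀} {L₀} {R₀} f = _≡_ {A = Arrow} (H₀ , L₀ ⊙₀ R₀ , f) (L₀ ⊙₀ R₀ , L₀ ⊙₀ R₀ , id)

  Analysable : ∀ {ℓ} → MorClass ℓ → ∀ {X Y} → Hom X Y → Set (o ⊔ h ⊔ ℓ)
  Analysable 𝔣 {X} {Y} g =
    ∃[ H₀ ] ∃[ L₀ ] ∃[ R₀ ] Σ (Hom H₀ (L₀ ⊙₀ R₀)) λ f → 𝔣 f ×
    (∃[ v ] Σ (Vec Obj (length v)) λ Bs → ∃[ Y₁ ] ∃[ Y₂ ]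
     Σ (Hom (Lᶠ L₀ v Bs) Y₁) λ g' → Σ (Hom (Rᶠ R₀ v Bs) Y₂) λ g'' →
     _≡_ {A = Arrow} (X , Y , g) (Hᶠ H₀ v Bs , Y₁ ⊙₀ Y₂ , (g' ⊙₁ g'') ∘ κ f v Bs))

{-# OPTIONS --safe #-}
module Submission where

-- Every κ^i_v(B⃗) with i ∈ Id^⊙ is built from an identity by the four steps k ↦ ᾱ ∘ (id ⊙ k),
-- ᾱ⁻¹ ∘ (k ⊙ id), δˡ ∘ (id ⊗ k), δʳ ∘ (k ⊗ id), and Id^⊙-analysable morphisms are closed under
-- these steps. For an atomic h the composite κ ∘ h is analysed by induction on h and on the
-- outermost one or two steps of κ. If h acts inside the object produced by the inner κ, it is
-- absorbed there (induction hypothesis); if it acts on the object added by the outermost step,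
-- naturality moves it to the left of κ. Otherwise h is a component of α^{±1}, ᾱ^{±1}, δˡ or δʳ
-- straddling the outermost steps, and one of (P2)–(P8), or an inverse law, rewrites κ ∘ h as
-- (g′ ⊙ g″) ∘ κ′. Tidiness rules out every combination in which the shapes of the target of h
-- and of the domain of κ disagree.

open import Defs
open import Level using (Level; _⊔_)
open import Data.List using ([]; _∷_; length)
open import Data.Vec using (Vec; []; _∷_; _∷ʳ_; init; last)
open import Data.Vec.Properties using (init-∷ʳ; last-∷ʳ)
open import Data.Product using (Σ; _,_; proj₁; proj₂)
open import Data.Empty using (⊥-elim)
open import Relation.Nullary using (¬_)
open import Relation.Binary.PropositionalEquality

module _ {o h : Level} (𝒞 : LDCat o h) where
  open LDCat 𝒞
  open ≡-Reasoning

  private variable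
    A B C D E H P Q A′ B′ C′ P′ Q′ X Y : Obj

  pullʳ : {a : Hom C D} {b : Hom B C} {c : Hom A B} {d : Hom A C} →
          b ∘ c ≡ d → (a ∘ b) ∘ c ≡ a ∘ d
  pullʳ {a = a} {b = b} {c = c} p = trans (assoc a b c) (cong (a ∘_) p)

  pullˡ : {a : Hom C D} {b : Hom B C} {c : Hom A B} {d : Hom B D} →
          a ∘ b ≡ d → a ∘ (b ∘ c) ≡ d ∘ c
  pullˡ {a = a} {b = b} {c = c} p = trans (sym (assoc a b c)) (cong (_∘ c) p)

  extendʳ : {a : Hom C D} {b : Hom B C} {c : Hom E D} {d : Hom B E} {f : Hom A B} →
            a ∘ b ≡ c ∘ d → a ∘ (b ∘ f) ≡ c ∘ (d ∘ f)
  extendʳ {c = c} {d = d} {f = f} p = trans (pullˡ p) (assoc c d f)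

  pushˡ : {a : Hom B C} {b : Hom D C} {c : Hom B D} {f : Hom A B} →
          a ≡ b ∘ c → a ∘ f ≡ b ∘ c ∘ f
  pushˡ {b = b} {c} {f} p = trans (cong (_∘ f) p) (assoc b c f)

  pullˡ³ : {a : Hom D E} {b : Hom C D} {c : Hom B C} {d : Hom B E} {f : Hom A B} →
           a ∘ b ∘ c ≡ d → a ∘ b ∘ c ∘ f ≡ d ∘ f
  pullˡ³ {a = a} {b} {c} {f = f} p = trans (cong (a ∘_) (sym (assoc b c f))) (pullˡ p)

  cancelˡ : {a : Hom B C} {b : Hom C B} {f : Hom A B} → b ∘ a ≡ id → b ∘ (a ∘ f) ≡ f
  cancelˡ {f = f} p = trans (pullˡ p) (identityˡ f)

  id-comm : (f : Hom A B) → id ∘ f ≡ f ∘ id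
  id-comm f = trans (identityˡ f) (sym (identityʳ f))

  module Bifunctor
    {_•₀_ : Obj → Obj → Obj}
    (_•₁_ : ∀ {A B C D} → Hom A B → Hom C D → Hom (A •₀ C) (B •₀ D))
    (•-id : ∀ {A B} → id {A} •₁ id {B} ≡ id)
    (•-∘ : ∀ {A B C A′ B′ C′} (f : Hom B C) (g : Hom A B) (f′ : Hom B′ C′) (g′ : Hom A′ B′) →
           (f ∘ g) •₁ (f′ ∘ g′) ≡ (f •₁ f′) ∘ (g •₁ g′))
    where

    first-∘ : (f : Hom B C) (g : Hom A B) → (f •₁ id {D}) ∘ (g •₁ id) ≡ (f ∘ g) •₁ id
    first-∘ f g = trans (sym (•-∘ f g id id)) (cong ((f ∘ g) •₁_) (identityˡ id))

    second-∘ : (f : Hom B C) (g : Hom A B) → (id {D} •₁ f) ∘ (id •₁ g) ≡ id •₁ (f ∘ g)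
    second-∘ f g = trans (sym (•-∘ id id f g)) (cong (_•₁ (f ∘ g)) (identityˡ id))

    first-second : (f : Hom A B) (g : Hom C D) → (f •₁ id) ∘ (id •₁ g) ≡ (id •₁ g) ∘ (f •₁ id)
    first-second f g = begin
      (f •₁ id) ∘ (id •₁ g)  ≡⟨ sym (•-∘ f id id g) ⟩
      (f ∘ id) •₁ (id ∘ g)   ≡⟨ cong₂ _•₁_ (sym (id-comm f)) (id-comm g) ⟩
      (id ∘ f) •₁ (g ∘ id)   ≡⟨ •-∘ id f g id ⟩
      (id •₁ g) ∘ (f •₁ id)  ∎

    first-inverse : {f : Hom A B} {g : Hom B A} → g ∘ f ≡ id → (g •₁ id {C}) ∘ (f •₁ id) ≡ id
    first-inverse p = trans (first-∘ _ _) (trans (cong (_•₁ id) p) •-id)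

    second-inverse : {f : Hom A B} {g : Hom B A} → g ∘ f ≡ id → (id {C} •₁ g) ∘ (id •₁ f) ≡ id
    second-inverse p = trans (second-∘ _ _) (trans (cong (id •₁_) p) •-id)

  module ⊗ = Bifunctor _⊗₁_ ⊗-id ⊗-∘
  module ⊙ = Bifunctor _⊙₁_ ⊙-id ⊙-∘

  invert-square : {i : Hom A B} {j : Hom B A} {i′ : Hom C D} {j′ : Hom D C}
                  {f : Hom B D} {g : Hom A C} →
                  i ∘ j ≡ id → j′ ∘ i′ ≡ id → f ∘ i ≡ i′ ∘ g → j′ ∘ f ≡ g ∘ j
  invert-square {i = i} {j = j} {i′ = i′} {j′ = j′} {f = f} {g = g} ij j′i′ sq = begin
    j′ ∘ f              ≡⟨ cong (j′ ∘_) (sym (trans (cong (f ∘_) ij) (identityʳ f))) ⟩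
    j′ ∘ (f ∘ (i ∘ j))  ≡⟨ cong (j′ ∘_) (pullˡ sq) ⟩
    j′ ∘ ((i′ ∘ g) ∘ j) ≡⟨ cong (j′ ∘_) (assoc i′ g j) ⟩
    j′ ∘ (i′ ∘ (g ∘ j)) ≡⟨ cancelˡ j′i′ ⟩
    g ∘ j               ∎

  transpose-inverse : {i : Hom A B} {j : Hom B A} {f : Hom B C} {g : Hom A C} →
                      i ∘ j ≡ id → f ∘ i ≡ g → g ∘ j ≡ f
  transpose-inverse {j = j} {f} ij sq =
    trans (cong (_∘ j) (sym sq)) (trans (pullʳ ij) (identityʳ f))

  inverse-∘ : {f : Hom A B} {g : Hom B A} {f′ : Hom B C} {g′ : Hom C B} →
              g ∘ f ≡ id → g′ ∘ f′ ≡ id → (g ∘ g′) ∘ f′ ∘ f ≡ id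
  inverse-∘ {f = f} {g} gf g′f′ = trans (pullʳ (pullˡ g′f′)) (trans (cong (g ∘_) (identityˡ f)) gf)

  ᾱ⁻¹-nat : (f : Hom A A′) (g : Hom B B′) (k : Hom C C′) →
            ᾱ⁻¹ A′ B′ C′ ∘ ((f ⊙₁ g) ⊙₁ k) ≡ (f ⊙₁ (g ⊙₁ k)) ∘ ᾱ⁻¹ A B C
  ᾱ⁻¹-nat f g k = invert-square (ᾱ-iso₁ _ _ _) (ᾱ-iso₂ _ _ _) (sym (ᾱ-nat f g k))

  ᾱ-nat₁ : (f : Hom A A′) → ᾱ A′ B C ∘ (f ⊙₁ id) ≡ ((f ⊙₁ id) ⊙₁ id) ∘ ᾱ A B C
  ᾱ-nat₁ f = trans (cong (λ z → ᾱ _ _ _ ∘ (f ⊙₁ z)) (sym ⊙-id)) (ᾱ-nat f id id)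

  ᾱ-nat₃ : (f : Hom C C′) → ᾱ A B C′ ∘ (id ⊙₁ (id ⊙₁ f)) ≡ (id ⊙₁ f) ∘ ᾱ A B C
  ᾱ-nat₃ f = trans (ᾱ-nat id id f) (cong (λ z → (z ⊙₁ f) ∘ ᾱ _ _ _) ⊙-id)

  ᾱ⁻¹-nat₃ : (f : Hom C C′) → ᾱ⁻¹ A B C′ ∘ (id ⊙₁ f) ≡ (id ⊙₁ (id ⊙₁ f)) ∘ ᾱ⁻¹ A B C
  ᾱ⁻¹-nat₃ f = trans (cong (λ z → ᾱ⁻¹ _ _ _ ∘ (z ⊙₁ f)) (sym ⊙-id)) (ᾱ⁻¹-nat id id f)

  δˡ-nat₁ : (f : Hom A A′) → δˡ A′ B C ∘ (f ⊗₁ id) ≡ ((f ⊗₁ id) ⊙₁ id) ∘ δˡ A B C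
  δˡ-nat₁ f = trans (cong (λ z → δˡ _ _ _ ∘ (f ⊗₁ z)) (sym ⊙-id)) (δˡ-nat f id id)

  δˡ-nat₃ : (f : Hom C C′) → δˡ A B C′ ∘ (id ⊗₁ (id ⊙₁ f)) ≡ (id ⊙₁ f) ∘ δˡ A B C
  δˡ-nat₃ f = trans (δˡ-nat id id f) (cong (λ z → (z ⊙₁ f) ∘ δˡ _ _ _) ⊗-id)

  δʳ-nat₁ : (f : Hom A A′) → δʳ A′ B C ∘ ((f ⊙₁ id) ⊗₁ id) ≡ (f ⊙₁ id) ∘ δʳ A B C
  δʳ-nat₁ f = trans (δʳ-nat f id id) (cong (λ z → (f ⊙₁ z) ∘ δʳ _ _ _) ⊗-id)

  δʳ-nat₃ : (f : Hom C C′) → δʳ A B C′ ∘ (id ⊗₁ f) ≡ (id ⊙₁ (id ⊗₁ f)) ∘ δʳ A B C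
  δʳ-nat₃ f = trans (cong (λ z → δʳ _ _ _ ∘ (z ⊗₁ f)) (sym ⊙-id)) (δʳ-nat id id f)

  α-nat₁ : (f : Hom A A′) → α A′ B C ∘ (f ⊗₁ id) ≡ ((f ⊗₁ id) ⊗₁ id) ∘ α A B C
  α-nat₁ f = trans (cong (λ z → α _ _ _ ∘ (f ⊗₁ z)) (sym ⊗-id)) (α-nat f id id)

  α-nat₃ : (f : Hom C C′) → α A B C′ ∘ (id ⊗₁ (id ⊗₁ f)) ≡ (id ⊗₁ f) ∘ α A B C
  α-nat₃ f = trans (α-nat id id f) (cong (λ z → (z ⊗₁ f) ∘ α _ _ _) ⊗-id)

  κᾱ : ∀ A → Hom H (P ⊙₀ Q) → Hom (A ⊙₀ H) ((A ⊙₀ P) ⊙₀ Q)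
  κᾱ A k = ᾱ A _ _ ∘ (id ⊙₁ k)

  κᾱ⁻¹ : ∀ A → Hom H (P ⊙₀ Q) → Hom (H ⊙₀ A) (P ⊙₀ (Q ⊙₀ A))
  κᾱ⁻¹ A k = ᾱ⁻¹ _ _ A ∘ (k ⊙₁ id)

  κδˡ : ∀ A → Hom H (P ⊙₀ Q) → Hom (A ⊗₀ H) ((A ⊗₀ P) ⊙₀ Q)
  κδˡ A k = δˡ A _ _ ∘ (id ⊗₁ k)

  κδʳ : ∀ A → Hom H (P ⊙₀ Q) → Hom (H ⊗₀ A) (P ⊙₀ (Q ⊗₀ A))
  κδʳ A k = δʳ _ _ A ∘ (k ⊗₁ id)

  κᾱ-id : κᾱ A (id {P ⊙₀ Q}) ≡ ᾱ A P Q
  κᾱ-id = trans (cong (ᾱ _ _ _ ∘_) ⊙-id) (identityʳ _)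

  κᾱ⁻¹-id : κᾱ⁻¹ A (id {P ⊙₀ Q}) ≡ ᾱ⁻¹ P Q A
  κᾱ⁻¹-id = trans (cong (ᾱ⁻¹ _ _ _ ∘_) ⊙-id) (identityʳ _)

  κδˡ-id : κδˡ A (id {P ⊙₀ Q}) ≡ δˡ A P Q
  κδˡ-id = trans (cong (δˡ _ _ _ ∘_) ⊗-id) (identityʳ _)

  κδʳ-id : κδʳ A (id {P ⊙₀ Q}) ≡ δʳ P Q A
  κδʳ-id = trans (cong (δʳ _ _ _ ∘_) ⊗-id) (identityʳ _)

  κᾱ-∘ : (k : Hom H (P ⊙₀ Q)) (f : Hom X H) → κᾱ A k ∘ (id ⊙₁ f) ≡ κᾱ A (k ∘ f)
  κᾱ-∘ k f = pullʳ (⊙.second-∘ k f)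

  κᾱ⁻¹-∘ : (k : Hom H (P ⊙₀ Q)) (f : Hom X H) → κᾱ⁻¹ A k ∘ (f ⊙₁ id) ≡ κᾱ⁻¹ A (k ∘ f)
  κᾱ⁻¹-∘ k f = pullʳ (⊙.first-∘ k f)

  κδˡ-∘ : (k : Hom H (P ⊙₀ Q)) (f : Hom X H) → κδˡ A k ∘ (id ⊗₁ f) ≡ κδˡ A (k ∘ f)
  κδˡ-∘ k f = pullʳ (⊗.second-∘ k f)

  κδʳ-∘ : (k : Hom H (P ⊙₀ Q)) (f : Hom X H) → κδʳ A k ∘ (f ⊗₁ id) ≡ κδʳ A (k ∘ f)
  κδʳ-∘ k f = pullʳ (⊗.first-∘ k f)

  κᾱ-nat : (f : Hom A A′) (k : Hom H (P ⊙₀ Q)) → κᾱ A′ k ∘ (f ⊙₁ id) ≡ ((f ⊙₁ id) ⊙₁ id) ∘ κᾱ A k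
  κᾱ-nat f k = trans (pullʳ (sym (⊙.first-second f k))) (extendʳ (ᾱ-nat₁ f))

  κᾱ⁻¹-nat : (f : Hom A A′) (k : Hom H (P ⊙₀ Q)) →
             κᾱ⁻¹ A′ k ∘ (id ⊙₁ f) ≡ (id ⊙₁ (id ⊙₁ f)) ∘ κᾱ⁻¹ A k
  κᾱ⁻¹-nat f k = trans (pullʳ (⊙.first-second k f)) (extendʳ (ᾱ⁻¹-nat₃ f))

  κδˡ-nat : (f : Hom A A′) (k : Hom H (P ⊙₀ Q)) → κδˡ A′ k ∘ (f ⊗₁ id) ≡ ((f ⊗₁ id) ⊙₁ id) ∘ κδˡ A k
  κδˡ-nat f k = trans (pullʳ (sym (⊗.first-second f k))) (extendʳ (δˡ-nat₁ f))

  κδʳ-nat : (f : Hom A A′) (k : Hom H (P ⊙₀ Q)) → κδʳ A′ k ∘ (id ⊗₁ f) ≡ (id ⊙₁ (id ⊗₁ f)) ∘ κδʳ A k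
  κδʳ-nat f k = trans (pullʳ (⊗.first-second k f)) (extendʳ (δʳ-nat₃ f))

  κᾱ-⊙ : (f : Hom P P′) (g : Hom Q Q′) (k : Hom H (P ⊙₀ Q)) →
         κᾱ A ((f ⊙₁ g) ∘ k) ≡ ((id ⊙₁ f) ⊙₁ g) ∘ κᾱ A k
  κᾱ-⊙ f g k = trans (cong (ᾱ _ _ _ ∘_) (sym (⊙.second-∘ _ k))) (extendʳ (ᾱ-nat id f g))

  κᾱ⁻¹-⊙ : (f : Hom P P′) (g : Hom Q Q′) (k : Hom H (P ⊙₀ Q)) →
           κᾱ⁻¹ A ((f ⊙₁ g) ∘ k) ≡ (f ⊙₁ (g ⊙₁ id)) ∘ κᾱ⁻¹ A k
  κᾱ⁻¹-⊙ f g k = trans (cong (ᾱ⁻¹ _ _ _ ∘_) (sym (⊙.first-∘ _ k))) (extendʳ (ᾱ⁻¹-nat f g id))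

  κδˡ-⊙ : (f : Hom P P′) (g : Hom Q Q′) (k : Hom H (P ⊙₀ Q)) →
          κδˡ A ((f ⊙₁ g) ∘ k) ≡ ((id ⊗₁ f) ⊙₁ g) ∘ κδˡ A k
  κδˡ-⊙ f g k = trans (cong (δˡ _ _ _ ∘_) (sym (⊗.second-∘ _ k))) (extendʳ (δˡ-nat id f g))

  κδʳ-⊙ : (f : Hom P P′) (g : Hom Q Q′) (k : Hom H (P ⊙₀ Q)) →
          κδʳ A ((f ⊙₁ g) ∘ k) ≡ (f ⊙₁ (g ⊗₁ id)) ∘ κδʳ A k
  κδʳ-⊙ f g k = trans (cong (δʳ _ _ _ ∘_) (sym (⊗.first-∘ _ k))) (extendʳ (δʳ-nat f g id))

  -- Inductive presentation of the morphisms κ^i_v(B⃗) with i ∈ Id^⊙.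
  data IsKappa : ∀ {H P Q} → Hom H (P ⊙₀ Q) → Set (o ⊔ h) where
    κ-id  : IsKappa (id {P ⊙₀ Q})
    κ-ᾱ   : ∀ A {k : Hom H (P ⊙₀ Q)} → IsKappa k → IsKappa (κᾱ A k)
    κ-ᾱ⁻¹ : ∀ A {k : Hom H (P ⊙₀ Q)} → IsKappa k → IsKappa (κᾱ⁻¹ A k)
    κ-δˡ  : ∀ A {k : Hom H (P ⊙₀ Q)} → IsKappa k → IsKappa (κδˡ A k)
    κ-δʳ  : ∀ A {k : Hom H (P ⊙₀ Q)} → IsKappa k → IsKappa (κδʳ A k)

  isKappa-κ : ∀ {L R} u (As : Vec Obj (length u)) → IsKappa (κ 𝒞 {L ⊙₀ R} {L} {R} id u As)
  isKappa-κ []           []       = κ-id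
  isKappa-κ (ᾱ-l   ∷ u) (A ∷ As) = κ-ᾱ A (isKappa-κ u As)
  isKappa-κ (ᾱ⁻¹-l ∷ u) As       = κ-ᾱ⁻¹ (last As) (isKappa-κ u (init As))
  isKappa-κ (δˡ-l  ∷ u) (A ∷ As) = κ-δˡ A (isKappa-κ u As)
  isKappa-κ (δʳ-l  ∷ u) As       = κ-δʳ (last As) (isKappa-κ u (init As))

  ArrowTo⊙ : Set (o ⊔ h)
  ArrowTo⊙ = Σ Obj λ H → Σ Obj λ P → Σ Obj λ Q → Hom H (P ⊙₀ Q)

  κ-arrow : ∀ L R v → Vec Obj (length v) → ArrowTo⊙
  κ-arrow L R v Bs = Hᶠ 𝒞 (L ⊙₀ R) v Bs , Lᶠ 𝒞 L v Bs , Rᶠ 𝒞 R v Bs , κ 𝒞 id v Bs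

  κ-arrow-ᾱ⁻¹ : ∀ L R v Bs A →
    κ-arrow L R (ᾱ⁻¹-l ∷ v) (Bs ∷ʳ A) ≡ (_ , _ , _ , κᾱ⁻¹ A (κ 𝒞 {L ⊙₀ R} {L} {R} id v Bs))
  κ-arrow-ᾱ⁻¹ L R v Bs A rewrite init-∷ʳ A Bs | last-∷ʳ A Bs = refl

  κ-arrow-δʳ : ∀ L R v Bs A →
    κ-arrow L R (δʳ-l ∷ v) (Bs ∷ʳ A) ≡ (_ , _ , _ , κδʳ A (κ 𝒞 {L ⊙₀ R} {L} {R} id v Bs))
  κ-arrow-δʳ L R v Bs A rewrite init-∷ʳ A Bs | last-∷ʳ A Bs = refl

  isKappa⇒κ : {k : Hom H (P ⊙₀ Q)} → IsKappa k →
              Σ Obj λ L → Σ Obj λ R → Σ 𝔷 λ v → Σ (Vec Obj (length v)) λ Bs →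
              (H , P , Q , k) ≡ κ-arrow L R v Bs
  isKappa⇒κ (κ-id {P} {Q}) = P , Q , [] , [] , refl
  isKappa⇒κ (κ-ᾱ A kk) with isKappa⇒κ kk
  ... | L , R , v , Bs , refl = L , R , ᾱ-l ∷ v , A ∷ Bs , refl
  isKappa⇒κ (κ-ᾱ⁻¹ A kk) with isKappa⇒κ kk
  ... | L , R , v , Bs , refl = L , R , ᾱ⁻¹-l ∷ v , Bs ∷ʳ A , sym (κ-arrow-ᾱ⁻¹ L R v Bs A)
  isKappa⇒κ (κ-δˡ A kk) with isKappa⇒κ kk
  ... | L , R , v , Bs , refl = L , R , δˡ-l ∷ v , A ∷ Bs , refl
  isKappa⇒κ (κ-δʳ A kk) with isKappa⇒κ kk
  ... | L , R , v , Bs , refl = L , R , δʳ-l ∷ v , Bs ∷ʳ A , sym (κ-arrow-δʳ L R v Bs A)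

  data IdAnalysable {X P′ Q′} : Hom X (P′ ⊙₀ Q′) → Set (o ⊔ h) where
    analysed : {k : Hom X (P ⊙₀ Q)} → IsKappa k → (g′ : Hom P P′) (g″ : Hom Q Q′) →
               IdAnalysable ((g′ ⊙₁ g″) ∘ k)

  IdAnalysable-resp : {g g′ : Hom X (P′ ⊙₀ Q′)} → g ≡ g′ → IdAnalysable g′ → IdAnalysable g
  IdAnalysable-resp refl a = a

  isKappa⇒IdAnalysable : {k : Hom H (P ⊙₀ Q)} → IsKappa k → IdAnalysable k
  isKappa⇒IdAnalysable {k = k} kk =
    IdAnalysable-resp (sym (trans (cong (_∘ k) ⊙-id) (identityˡ k))) (analysed kk id id)

  analysed-≡ : {g : Hom X (P′ ⊙₀ Q′)} {f : Hom P P′} {f′ : Hom Q Q′} {k : Hom X (P ⊙₀ Q)} →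
               g ≡ (f ⊙₁ f′) ∘ k → IsKappa k → IdAnalysable g
  analysed-≡ eq kk = IdAnalysable-resp eq (analysed kk _ _)

  kappa-≡ : {g k : Hom X (P ⊙₀ Q)} → g ≡ k → IsKappa k → IdAnalysable g
  kappa-≡ eq kk = IdAnalysable-resp eq (isKappa⇒IdAnalysable kk)

  IdAnalysable-κᾱ : {k : Hom H (P ⊙₀ Q)} → IdAnalysable k → IdAnalysable (κᾱ A k)
  IdAnalysable-κᾱ (analysed kk f g) = IdAnalysable-resp (κᾱ-⊙ f g _) (analysed (κ-ᾱ _ kk) _ _)

  IdAnalysable-κᾱ⁻¹ : {k : Hom H (P ⊙₀ Q)} → IdAnalysable k → IdAnalysable (κᾱ⁻¹ A k)
  IdAnalysable-κᾱ⁻¹ (analysed kk f g) = IdAnalysable-resp (κᾱ⁻¹-⊙ f g _) (analysed (κ-ᾱ⁻¹ _ kk) _ _)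

  IdAnalysable-κδˡ : {k : Hom H (P ⊙₀ Q)} → IdAnalysable k → IdAnalysable (κδˡ A k)
  IdAnalysable-κδˡ (analysed kk f g) = IdAnalysable-resp (κδˡ-⊙ f g _) (analysed (κ-δˡ _ kk) _ _)

  IdAnalysable-κδʳ : {k : Hom H (P ⊙₀ Q)} → IdAnalysable k → IdAnalysable (κδʳ A k)
  IdAnalysable-κδʳ (analysed kk f g) = IdAnalysable-resp (κδʳ-⊙ f g _) (analysed (κ-δʳ _ kk) _ _)

  IdAnalysable⇒Analysable : {g : Hom X (P′ ⊙₀ Q′)} → IdAnalysable g → Analysable 𝒞 (Id⊙ 𝒞) g
  IdAnalysable⇒Analysable {P′ = P′} {Q′} (analysed kk g′ g″) with isKappa⇒κ kk
  ... | L , R , v , Bs , refl = L ⊙₀ R , L , R , id , refl , v , Bs , P′ , Q′ , g′ , g″ , refl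

  κᾱ-ᾱ : ∀ C D (k : Hom H (P ⊙₀ Q)) →
         κᾱ (C ⊙₀ D) k ∘ ᾱ C D H ≡ (ᾱ C D P ⊙₁ id) ∘ κᾱ C (κᾱ D k)
  κᾱ-ᾱ {P = P} {Q = Q} C D k = begin
    (ᾱ (C ⊙₀ D) P Q ∘ (id ⊙₁ k)) ∘ ᾱ C D _
      ≡⟨ pullʳ (sym (ᾱ-nat₃ k)) ⟩
    ᾱ (C ⊙₀ D) P Q ∘ ᾱ C D (P ⊙₀ Q) ∘ (id ⊙₁ (id ⊙₁ k))
      ≡⟨ extendʳ (P8 C D P Q) ⟩
    (ᾱ C D P ⊙₁ id) ∘ (ᾱ C (D ⊙₀ P) Q ∘ (id ⊙₁ ᾱ D P Q)) ∘ (id ⊙₁ (id ⊙₁ k))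
      ≡⟨ cong ((ᾱ C D P ⊙₁ id) ∘_) (pullʳ (⊙.second-∘ _ _)) ⟩
    (ᾱ C D P ⊙₁ id) ∘ κᾱ C (κᾱ D k) ∎

  κᾱκᾱ-ᾱ⁻¹ : ∀ A B (k : Hom H (P ⊙₀ Q)) →
             κᾱ A (κᾱ B k) ∘ ᾱ⁻¹ A B H ≡ (ᾱ⁻¹ A B P ⊙₁ id) ∘ κᾱ (A ⊙₀ B) k
  κᾱκᾱ-ᾱ⁻¹ A B k =
    sym (invert-square (ᾱ-iso₁ _ _ _) (⊙.first-inverse (ᾱ-iso₂ _ _ _)) (κᾱ-ᾱ A B k))

  κᾱ-δˡ : ∀ C D (k : Hom H (P ⊙₀ Q)) →
          κᾱ (C ⊗₀ D) k ∘ δˡ C D H ≡ (δˡ C D P ⊙₁ id) ∘ κδˡ C (κᾱ D k)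
  κᾱ-δˡ {P = P} {Q = Q} C D k = begin
    (ᾱ (C ⊗₀ D) P Q ∘ (id ⊙₁ k)) ∘ δˡ C D _
      ≡⟨ pullʳ (sym (δˡ-nat₃ k)) ⟩
    ᾱ (C ⊗₀ D) P Q ∘ δˡ C D (P ⊙₀ Q) ∘ (id ⊗₁ (id ⊙₁ k))
      ≡⟨ extendʳ (P4 C D P Q) ⟩
    (δˡ C D P ⊙₁ id) ∘ (δˡ C (D ⊙₀ P) Q ∘ (id ⊗₁ ᾱ D P Q)) ∘ (id ⊗₁ (id ⊙₁ k))
      ≡⟨ cong ((δˡ C D P ⊙₁ id) ∘_) (pullʳ (⊗.second-∘ _ _)) ⟩
    (δˡ C D P ⊙₁ id) ∘ κδˡ C (κᾱ D k) ∎

  κᾱκδˡ-δʳ : ∀ A B (k : Hom H (P ⊙₀ Q)) →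
             κᾱ A (κδˡ B k) ∘ δʳ A B H ≡ (δʳ A B P ⊙₁ id) ∘ κδˡ (A ⊙₀ B) k
  κᾱκδˡ-δʳ {P = P} {Q = Q} A B k = begin
    (ᾱ A (B ⊗₀ P) Q ∘ (id ⊙₁ (δˡ B P Q ∘ (id ⊗₁ k)))) ∘ δʳ A B _
      ≡⟨ pullʳ (pushˡ (sym (⊙.second-∘ _ _))) ⟩
    ᾱ A (B ⊗₀ P) Q ∘ (id ⊙₁ δˡ B P Q) ∘ (id ⊙₁ (id ⊗₁ k)) ∘ δʳ A B _
      ≡⟨ cong (λ z → ᾱ A (B ⊗₀ P) Q ∘ (id ⊙₁ δˡ B P Q) ∘ z) (sym (δʳ-nat₃ k)) ⟩
    ᾱ A (B ⊗₀ P) Q ∘ (id ⊙₁ δˡ B P Q) ∘ δʳ A B (P ⊙₀ Q) ∘ (id ⊗₁ k)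
      ≡⟨ pullˡ³ (sym (P6 A B P Q)) ⟩
    ((δʳ A B P ⊙₁ id) ∘ δˡ (A ⊙₀ B) P Q) ∘ (id ⊗₁ k)
      ≡⟨ assoc _ _ _ ⟩
    (δʳ A B P ⊙₁ id) ∘ κδˡ (A ⊙₀ B) k ∎

  κᾱκδʳ-δʳ : ∀ A B (k : Hom H (P ⊙₀ Q)) →
             κᾱ A (κδʳ B k) ∘ δʳ A H B ≡ κδʳ B (κᾱ A k)
  κᾱκδʳ-δʳ {P = P} {Q = Q} A B k = begin
    (ᾱ A P (Q ⊗₀ B) ∘ (id ⊙₁ (δʳ P Q B ∘ (k ⊗₁ id)))) ∘ δʳ A _ B
      ≡⟨ pullʳ (pushˡ (sym (⊙.second-∘ _ _))) ⟩
    ᾱ A P (Q ⊗₀ B) ∘ (id ⊙₁ δʳ P Q B) ∘ (id ⊙₁ (k ⊗₁ id)) ∘ δʳ A _ B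
      ≡⟨ cong (λ z → ᾱ A P (Q ⊗₀ B) ∘ (id ⊙₁ δʳ P Q B) ∘ z) (sym (δʳ-nat id k id)) ⟩
    ᾱ A P (Q ⊗₀ B) ∘ (id ⊙₁ δʳ P Q B) ∘ δʳ A (P ⊙₀ Q) B ∘ ((id ⊙₁ k) ⊗₁ id)
      ≡⟨ pullˡ³ (sym (P7 A P Q B)) ⟩
    (δʳ (A ⊙₀ P) Q B ∘ (ᾱ A P Q ⊗₁ id)) ∘ ((id ⊙₁ k) ⊗₁ id)
      ≡⟨ pullʳ (⊗.first-∘ _ _) ⟩
    κδʳ B (κᾱ A k) ∎

  κᾱ⁻¹κᾱ-ᾱ : ∀ A B (k : Hom H (P ⊙₀ Q)) →
             κᾱ⁻¹ B (κᾱ A k) ∘ ᾱ A H B ≡ κᾱ A (κᾱ⁻¹ B k)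
  κᾱ⁻¹κᾱ-ᾱ {P = P} {Q = Q} A B k = begin
    (ᾱ⁻¹ (A ⊙₀ P) Q B ∘ ((ᾱ A P Q ∘ (id ⊙₁ k)) ⊙₁ id)) ∘ ᾱ A _ B
      ≡⟨ pullʳ (pushˡ (sym (⊙.first-∘ _ _))) ⟩
    ᾱ⁻¹ (A ⊙₀ P) Q B ∘ (ᾱ A P Q ⊙₁ id) ∘ ((id ⊙₁ k) ⊙₁ id) ∘ ᾱ A _ B
      ≡⟨ cong (λ z → ᾱ⁻¹ (A ⊙₀ P) Q B ∘ (ᾱ A P Q ⊙₁ id) ∘ z) (sym (ᾱ-nat id k id)) ⟩
    ᾱ⁻¹ (A ⊙₀ P) Q B ∘ (ᾱ A P Q ⊙₁ id) ∘ ᾱ A (P ⊙₀ Q) B ∘ (id ⊙₁ (k ⊙₁ id))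
      ≡⟨ pullˡ³ pentagon ⟩
    (ᾱ A P (Q ⊙₀ B) ∘ (id ⊙₁ ᾱ⁻¹ P Q B)) ∘ (id ⊙₁ (k ⊙₁ id))
      ≡⟨ pullʳ (⊙.second-∘ _ _) ⟩
    κᾱ A (κᾱ⁻¹ B k) ∎
    where
    pentagon : ᾱ⁻¹ (A ⊙₀ P) Q B ∘ (ᾱ A P Q ⊙₁ id) ∘ ᾱ A (P ⊙₀ Q) B
             ≡ ᾱ A P (Q ⊙₀ B) ∘ (id ⊙₁ ᾱ⁻¹ P Q B)
    pentagon = invert-square (⊙.second-inverse (ᾱ-iso₁ _ _ _)) (ᾱ-iso₂ _ _ _)
                             (trans (assoc _ _ _) (sym (P8 A P Q B)))

  κᾱκᾱ⁻¹-ᾱ⁻¹ : ∀ A B (k : Hom H (P ⊙₀ Q)) →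
               κᾱ A (κᾱ⁻¹ B k) ∘ ᾱ⁻¹ A H B ≡ κᾱ⁻¹ B (κᾱ A k)
  κᾱκᾱ⁻¹-ᾱ⁻¹ A B k = transpose-inverse (ᾱ-iso₁ _ _ _) (κᾱ⁻¹κᾱ-ᾱ A B k)

  κᾱ⁻¹κᾱ⁻¹-ᾱ : ∀ A B (k : Hom H (P ⊙₀ Q)) →
               κᾱ⁻¹ B (κᾱ⁻¹ A k) ∘ ᾱ H A B ≡ (id ⊙₁ ᾱ Q A B) ∘ κᾱ⁻¹ (A ⊙₀ B) k
  κᾱ⁻¹κᾱ⁻¹-ᾱ {P = P} {Q = Q} A B k = begin
    (ᾱ⁻¹ P (Q ⊙₀ A) B ∘ ((ᾱ⁻¹ P Q A ∘ (k ⊙₁ id)) ⊙₁ id)) ∘ ᾱ _ A B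
      ≡⟨ pullʳ (pushˡ (sym (⊙.first-∘ _ _))) ⟩
    ᾱ⁻¹ P (Q ⊙₀ A) B ∘ (ᾱ⁻¹ P Q A ⊙₁ id) ∘ ((k ⊙₁ id) ⊙₁ id) ∘ ᾱ _ A B
      ≡⟨ cong (λ z → ᾱ⁻¹ P (Q ⊙₀ A) B ∘ (ᾱ⁻¹ P Q A ⊙₁ id) ∘ z) (sym (ᾱ-nat₁ k)) ⟩
    ᾱ⁻¹ P (Q ⊙₀ A) B ∘ (ᾱ⁻¹ P Q A ⊙₁ id) ∘ ᾱ (P ⊙₀ Q) A B ∘ (k ⊙₁ id)
      ≡⟨ pullˡ³ pentagon ⟩
    ((id ⊙₁ ᾱ Q A B) ∘ ᾱ⁻¹ P Q (A ⊙₀ B)) ∘ (k ⊙₁ id)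
      ≡⟨ assoc _ _ _ ⟩
    (id ⊙₁ ᾱ Q A B) ∘ κᾱ⁻¹ (A ⊙₀ B) k ∎
    where
    pentagon : ᾱ⁻¹ P (Q ⊙₀ A) B ∘ (ᾱ⁻¹ P Q A ⊙₁ id) ∘ ᾱ (P ⊙₀ Q) A B
             ≡ (id ⊙₁ ᾱ Q A B) ∘ ᾱ⁻¹ P Q (A ⊙₀ B)
    pentagon = trans (sym (assoc _ _ _))
      (invert-square (ᾱ-iso₁ _ _ _) (inverse-∘ (ᾱ-iso₂ _ _ _) (⊙.first-inverse (ᾱ-iso₂ _ _ _)))
                     (trans (P8 P Q A B) (sym (assoc _ _ _))))

  κᾱ⁻¹-ᾱ⁻¹ : ∀ C D (k : Hom H (P ⊙₀ Q)) →
             κᾱ⁻¹ (C ⊙₀ D) k ∘ ᾱ⁻¹ H C D ≡ (id ⊙₁ ᾱ⁻¹ Q C D) ∘ κᾱ⁻¹ D (κᾱ⁻¹ C k)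
  κᾱ⁻¹-ᾱ⁻¹ C D k =
    sym (invert-square (ᾱ-iso₁ _ _ _) (⊙.second-inverse (ᾱ-iso₂ _ _ _)) (κᾱ⁻¹κᾱ⁻¹-ᾱ C D k))

  κᾱ⁻¹κδˡ-δˡ : ∀ A B (k : Hom H (P ⊙₀ Q)) →
               κᾱ⁻¹ B (κδˡ A k) ∘ δˡ A H B ≡ κδˡ A (κᾱ⁻¹ B k)
  κᾱ⁻¹κδˡ-δˡ {P = P} {Q = Q} A B k = begin
    (ᾱ⁻¹ (A ⊗₀ P) Q B ∘ ((δˡ A P Q ∘ (id ⊗₁ k)) ⊙₁ id)) ∘ δˡ A _ B
      ≡⟨ pullʳ (pushˡ (sym (⊙.first-∘ _ _))) ⟩
    ᾱ⁻¹ (A ⊗₀ P) Q B ∘ (δˡ A P Q ⊙₁ id) ∘ ((id ⊗₁ k) ⊙₁ id) ∘ δˡ A _ B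
      ≡⟨ cong (λ z → ᾱ⁻¹ (A ⊗₀ P) Q B ∘ (δˡ A P Q ⊙₁ id) ∘ z) (sym (δˡ-nat id k id)) ⟩
    ᾱ⁻¹ (A ⊗₀ P) Q B ∘ (δˡ A P Q ⊙₁ id) ∘ δˡ A (P ⊙₀ Q) B ∘ (id ⊗₁ (k ⊙₁ id))
      ≡⟨ pullˡ³ coherence ⟩
    (δˡ A P (Q ⊙₀ B) ∘ (id ⊗₁ ᾱ⁻¹ P Q B)) ∘ (id ⊗₁ (k ⊙₁ id))
      ≡⟨ pullʳ (⊗.second-∘ _ _) ⟩
    κδˡ A (κᾱ⁻¹ B k) ∎
    where
    coherence : ᾱ⁻¹ (A ⊗₀ P) Q B ∘ (δˡ A P Q ⊙₁ id) ∘ δˡ A (P ⊙₀ Q) B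
              ≡ δˡ A P (Q ⊙₀ B) ∘ (id ⊗₁ ᾱ⁻¹ P Q B)
    coherence = invert-square (⊗.second-inverse (ᾱ-iso₁ _ _ _)) (ᾱ-iso₂ _ _ _)
                              (trans (assoc _ _ _) (sym (P4 A P Q B)))

  κᾱ⁻¹κδʳ-δˡ : ∀ A B (k : Hom H (P ⊙₀ Q)) →
               κᾱ⁻¹ B (κδʳ A k) ∘ δˡ H A B ≡ (id ⊙₁ δˡ Q A B) ∘ κδʳ (A ⊙₀ B) k
  κᾱ⁻¹κδʳ-δˡ {P = P} {Q = Q} A B k = begin
    (ᾱ⁻¹ P (Q ⊗₀ A) B ∘ ((δʳ P Q A ∘ (k ⊗₁ id)) ⊙₁ id)) ∘ δˡ _ A B
      ≡⟨ pullʳ (pushˡ (sym (⊙.first-∘ _ _))) ⟩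
    ᾱ⁻¹ P (Q ⊗₀ A) B ∘ (δʳ P Q A ⊙₁ id) ∘ ((k ⊗₁ id) ⊙₁ id) ∘ δˡ _ A B
      ≡⟨ cong (λ z → ᾱ⁻¹ P (Q ⊗₀ A) B ∘ (δʳ P Q A ⊙₁ id) ∘ z) (sym (δˡ-nat₁ k)) ⟩
    ᾱ⁻¹ P (Q ⊗₀ A) B ∘ (δʳ P Q A ⊙₁ id) ∘ δˡ (P ⊙₀ Q) A B ∘ (k ⊗₁ id)
      ≡⟨ pullˡ³ (trans (cong (ᾱ⁻¹ P (Q ⊗₀ A) B ∘_) (P6 P Q A B)) (cancelˡ (ᾱ-iso₂ _ _ _))) ⟩
    ((id ⊙₁ δˡ Q A B) ∘ δʳ P Q (A ⊙₀ B)) ∘ (k ⊗₁ id)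
      ≡⟨ assoc _ _ _ ⟩
    (id ⊙₁ δˡ Q A B) ∘ κδʳ (A ⊙₀ B) k ∎

  κᾱ⁻¹-δʳ : ∀ C D (k : Hom H (P ⊙₀ Q)) →
            κᾱ⁻¹ (C ⊗₀ D) k ∘ δʳ H C D ≡ (id ⊙₁ δʳ Q C D) ∘ κδʳ D (κᾱ⁻¹ C k)
  κᾱ⁻¹-δʳ {P = P} {Q = Q} C D k = begin
    (ᾱ⁻¹ P Q (C ⊗₀ D) ∘ (k ⊙₁ id)) ∘ δʳ _ C D
      ≡⟨ pullʳ (sym (δʳ-nat₁ k)) ⟩
    ᾱ⁻¹ P Q (C ⊗₀ D) ∘ δʳ (P ⊙₀ Q) C D ∘ ((k ⊙₁ id) ⊗₁ id)
      ≡⟨ pullˡ coherence ⟩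
    (((id ⊙₁ δʳ Q C D) ∘ δʳ P (Q ⊙₀ C) D) ∘ (ᾱ⁻¹ P Q C ⊗₁ id)) ∘ ((k ⊙₁ id) ⊗₁ id)
      ≡⟨ pullʳ (⊗.first-∘ _ _) ⟩
    ((id ⊙₁ δʳ Q C D) ∘ δʳ P (Q ⊙₀ C) D) ∘ ((ᾱ⁻¹ P Q C ∘ (k ⊙₁ id)) ⊗₁ id)
      ≡⟨ assoc _ _ _ ⟩
    (id ⊙₁ δʳ Q C D) ∘ κδʳ D (κᾱ⁻¹ C k) ∎
    where
    coherence : ᾱ⁻¹ P Q (C ⊗₀ D) ∘ δʳ (P ⊙₀ Q) C D
              ≡ ((id ⊙₁ δʳ Q C D) ∘ δʳ P (Q ⊙₀ C) D) ∘ (ᾱ⁻¹ P Q C ⊗₁ id)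
    coherence = invert-square (⊗.first-inverse (ᾱ-iso₁ _ _ _)) (ᾱ-iso₂ _ _ _) (P7 P Q C D)

  κδˡ-α : ∀ C D (k : Hom H (P ⊙₀ Q)) →
          κδˡ (C ⊗₀ D) k ∘ α C D H ≡ (α C D P ⊙₁ id) ∘ κδˡ C (κδˡ D k)
  κδˡ-α {P = P} {Q = Q} C D k = begin
    (δˡ (C ⊗₀ D) P Q ∘ (id ⊗₁ k)) ∘ α C D _
      ≡⟨ pullʳ (sym (α-nat₃ k)) ⟩
    δˡ (C ⊗₀ D) P Q ∘ α C D (P ⊙₀ Q) ∘ (id ⊗₁ (id ⊗₁ k))
      ≡⟨ extendʳ (P2 C D P Q) ⟩
    (α C D P ⊙₁ id) ∘ (δˡ C (D ⊗₀ P) Q ∘ (id ⊗₁ δˡ D P Q)) ∘ (id ⊗₁ (id ⊗₁ k))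
      ≡⟨ cong ((α C D P ⊙₁ id) ∘_) (pullʳ (⊗.second-∘ _ _)) ⟩
    (α C D P ⊙₁ id) ∘ κδˡ C (κδˡ D k) ∎

  κδˡκδˡ-α⁻¹ : ∀ A B (k : Hom H (P ⊙₀ Q)) →
               κδˡ A (κδˡ B k) ∘ α⁻¹ A B H ≡ (α⁻¹ A B P ⊙₁ id) ∘ κδˡ (A ⊗₀ B) k
  κδˡκδˡ-α⁻¹ A B k =
    sym (invert-square (α-iso₁ _ _ _) (⊙.first-inverse (α-iso₂ _ _ _)) (κδˡ-α A B k))

  κδʳκδˡ-α : ∀ A B (k : Hom H (P ⊙₀ Q)) →
             κδʳ B (κδˡ A k) ∘ α A H B ≡ κδˡ A (κδʳ B k)
  κδʳκδˡ-α {P = P} {Q = Q} A B k = begin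
    (δʳ (A ⊗₀ P) Q B ∘ ((δˡ A P Q ∘ (id ⊗₁ k)) ⊗₁ id)) ∘ α A _ B
      ≡⟨ pullʳ (pushˡ (sym (⊗.first-∘ _ _))) ⟩
    δʳ (A ⊗₀ P) Q B ∘ (δˡ A P Q ⊗₁ id) ∘ ((id ⊗₁ k) ⊗₁ id) ∘ α A _ B
      ≡⟨ cong (λ z → δʳ (A ⊗₀ P) Q B ∘ (δˡ A P Q ⊗₁ id) ∘ z) (sym (α-nat id k id)) ⟩
    δʳ (A ⊗₀ P) Q B ∘ (δˡ A P Q ⊗₁ id) ∘ α A (P ⊙₀ Q) B ∘ (id ⊗₁ (k ⊗₁ id))
      ≡⟨ pullˡ³ (sym (P3 A P Q B)) ⟩
    (δˡ A P (Q ⊗₀ B) ∘ (id ⊗₁ δʳ P Q B)) ∘ (id ⊗₁ (k ⊗₁ id))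
      ≡⟨ pullʳ (⊗.second-∘ _ _) ⟩
    κδˡ A (κδʳ B k) ∎

  κδˡκδʳ-α⁻¹ : ∀ A B (k : Hom H (P ⊙₀ Q)) →
               κδˡ A (κδʳ B k) ∘ α⁻¹ A H B ≡ κδʳ B (κδˡ A k)
  κδˡκδʳ-α⁻¹ A B k = transpose-inverse (α-iso₁ _ _ _) (κδʳκδˡ-α A B k)

  κδʳκδʳ-α : ∀ A B (k : Hom H (P ⊙₀ Q)) →
             κδʳ B (κδʳ A k) ∘ α H A B ≡ (id ⊙₁ α Q A B) ∘ κδʳ (A ⊗₀ B) k
  κδʳκδʳ-α {P = P} {Q = Q} A B k = begin
    (δʳ P (Q ⊗₀ A) B ∘ ((δʳ P Q A ∘ (k ⊗₁ id)) ⊗₁ id)) ∘ α _ A B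
      ≡⟨ pullʳ (pushˡ (sym (⊗.first-∘ _ _))) ⟩
    δʳ P (Q ⊗₀ A) B ∘ (δʳ P Q A ⊗₁ id) ∘ ((k ⊗₁ id) ⊗₁ id) ∘ α _ A B
      ≡⟨ cong (λ z → δʳ P (Q ⊗₀ A) B ∘ (δʳ P Q A ⊗₁ id) ∘ z) (sym (α-nat₁ k)) ⟩
    δʳ P (Q ⊗₀ A) B ∘ (δʳ P Q A ⊗₁ id) ∘ α (P ⊙₀ Q) A B ∘ (k ⊗₁ id)
      ≡⟨ pullˡ³ (sym (P5 P Q A B)) ⟩
    ((id ⊙₁ α Q A B) ∘ δʳ P Q (A ⊗₀ B)) ∘ (k ⊗₁ id)
      ≡⟨ assoc _ _ _ ⟩
    (id ⊙₁ α Q A B) ∘ κδʳ (A ⊗₀ B) k ∎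

  κδʳ-α⁻¹ : ∀ C D (k : Hom H (P ⊙₀ Q)) →
            κδʳ (C ⊗₀ D) k ∘ α⁻¹ H C D ≡ (id ⊙₁ α⁻¹ Q C D) ∘ κδʳ D (κδʳ C k)
  κδʳ-α⁻¹ C D k =
    sym (invert-square (α-iso₁ _ _ _) (⊙.second-inverse (α-iso₂ _ _ _)) (κδʳκδʳ-α C D k))

  module _ (T : Tidy 𝒞) where
    open Tidy T

    ⊙≢⊗ : ¬ (A ⊙₀ B ≡ C ⊗₀ D)
    ⊙≢⊗ e = ⊗≢⊙ (sym e)

    ⊙-inj₁ : A ⊙₀ B ≡ C ⊙₀ D → A ≡ C
    ⊙-inj₁ e = proj₁ (⊙-inj e)

    ⊙-inj₂ : A ⊙₀ B ≡ C ⊙₀ D → B ≡ D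
    ⊙-inj₂ e = proj₂ (⊙-inj e)

    ⊗-inj₁ : A ⊗₀ B ≡ C ⊗₀ D → A ≡ C
    ⊗-inj₁ e = proj₁ (⊗-inj e)

    ⊗-inj₂ : A ⊗₀ B ≡ C ⊗₀ D → B ≡ D
    ⊗-inj₂ e = proj₂ (⊗-inj e)

    -- The target of h is matched against the domain of k through the equation e, because ⊗₀ and ⊙₀
    -- are not constructors; tidiness decomposes e, and then e is refl by K.
    kappa∘atomic : {k : Hom H (P ⊙₀ Q)} {h : Hom X Y} →
                   IsKappa k → Atomic 𝒞 h → (e : Y ≡ H) → IdAnalysable (k ∘ subst (Hom X) e h)
    id∘atomic : {h : Hom X Y} →
                Atomic 𝒞 h → (e : Y ≡ P ⊙₀ Q) → IdAnalysable (id ∘ subst (Hom X) e h)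
    κᾱ∘atomic : {k : Hom H (P ⊙₀ Q)} {h : Hom X Y} →
                IsKappa k → Atomic 𝒞 h → (e : Y ≡ A ⊙₀ H) →
                IdAnalysable (κᾱ A k ∘ subst (Hom X) e h)
    κᾱ⁻¹∘atomic : {k : Hom H (P ⊙₀ Q)} {h : Hom X Y} →
                  IsKappa k → Atomic 𝒞 h → (e : Y ≡ H ⊙₀ A) →
                  IdAnalysable (κᾱ⁻¹ A k ∘ subst (Hom X) e h)
    κδˡ∘atomic : {k : Hom H (P ⊙₀ Q)} {h : Hom X Y} →
                 IsKappa k → Atomic 𝒞 h → (e : Y ≡ A ⊗₀ H) →
                 IdAnalysable (κδˡ A k ∘ subst (Hom X) e h)
    κδʳ∘atomic : {k : Hom H (P ⊙₀ Q)} {h : Hom X Y} →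
                 IsKappa k → Atomic 𝒞 h → (e : Y ≡ H ⊗₀ A) →
                 IdAnalysable (κδʳ A k ∘ subst (Hom X) e h)

    kappa∘atomic κ-id         = id∘atomic
    kappa∘atomic (κ-ᾱ _ kk)   = κᾱ∘atomic kk
    kappa∘atomic (κ-ᾱ⁻¹ _ kk) = κᾱ⁻¹∘atomic kk
    kappa∘atomic (κ-δˡ _ kk)  = κδˡ∘atomic kk
    kappa∘atomic (κ-δʳ _ kk)  = κδʳ∘atomic kk

    id∘atomic (at-α _ _ _)   e = ⊥-elim (⊗≢⊙ e)
    id∘atomic (at-α⁻¹ _ _ _) e = ⊥-elim (⊗≢⊙ e)
    id∘atomic (at-⊗ˡ _ _)    e = ⊥-elim (⊗≢⊙ e)
    id∘atomic (at-⊗ʳ _ _)    e = ⊥-elim (⊗≢⊙ e)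
    id∘atomic (at-ᾱ C D E) e with ⊙-inj e | e
    ... | refl , refl | refl = kappa-≡ (trans (identityˡ _) (sym κᾱ-id)) (κ-ᾱ C κ-id)
    id∘atomic (at-ᾱ⁻¹ C D E) e with ⊙-inj e | e
    ... | refl , refl | refl = kappa-≡ (trans (identityˡ _) (sym κᾱ⁻¹-id)) (κ-ᾱ⁻¹ E κ-id)
    id∘atomic (at-δˡ C D E) e with ⊙-inj e | e
    ... | refl , refl | refl = kappa-≡ (trans (identityˡ _) (sym κδˡ-id)) (κ-δˡ C κ-id)
    id∘atomic (at-δʳ C D E) e with ⊙-inj e | e
    ... | refl , refl | refl = kappa-≡ (trans (identityˡ _) (sym κδʳ-id)) (κ-δʳ E κ-id)
    id∘atomic (at-⊙ˡ _ _) e with ⊙-inj e | e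
    ... | refl , refl | refl = analysed-≡ (id-comm _) κ-id
    id∘atomic (at-⊙ʳ _ _) e with ⊙-inj e | e
    ... | refl , refl | refl = analysed-≡ (id-comm _) κ-id

    κᾱ∘atomic _ (at-α _ _ _)   e = ⊥-elim (⊗≢⊙ e)
    κᾱ∘atomic _ (at-α⁻¹ _ _ _) e = ⊥-elim (⊗≢⊙ e)
    κᾱ∘atomic _ (at-⊗ˡ _ _)    e = ⊥-elim (⊗≢⊙ e)
    κᾱ∘atomic _ (at-⊗ʳ _ _)    e = ⊥-elim (⊗≢⊙ e)
    κᾱ∘atomic kk (at-ᾱ C D E) e with ⊙-inj e | e
    ... | refl , refl | refl = analysed-≡ (κᾱ-ᾱ C D _) (κ-ᾱ C (κ-ᾱ D kk))
    κᾱ∘atomic κ-id (at-ᾱ⁻¹ C D E) e with ⊙-inj e | ⊙-inj (⊙-inj₂ e) | e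
    ... | refl , _ | refl , refl | refl = kappa-≡ (trans (cong (_∘ _) κᾱ-id) (ᾱ-iso₁ C D E)) κ-id
    κᾱ∘atomic (κ-ᾱ _ kk) (at-ᾱ⁻¹ C D E) e with ⊙-inj e | ⊙-inj (⊙-inj₂ e) | e
    ... | refl , _ | refl , refl | refl = analysed-≡ (κᾱκᾱ-ᾱ⁻¹ C D _) (κ-ᾱ (C ⊙₀ D) kk)
    κᾱ∘atomic (κ-ᾱ⁻¹ _ kk) (at-ᾱ⁻¹ C D E) e with ⊙-inj e | ⊙-inj (⊙-inj₂ e) | e
    ... | refl , _ | refl , refl | refl = kappa-≡ (κᾱκᾱ⁻¹-ᾱ⁻¹ C E _) (κ-ᾱ⁻¹ E (κ-ᾱ C kk))
    κᾱ∘atomic (κ-δˡ _ _) (at-ᾱ⁻¹ _ _ _) e = ⊥-elim (⊙≢⊗ (⊙-inj₂ e))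
    κᾱ∘atomic (κ-δʳ _ _) (at-ᾱ⁻¹ _ _ _) e = ⊥-elim (⊙≢⊗ (⊙-inj₂ e))
    κᾱ∘atomic kk (at-δˡ C D E) e with ⊙-inj e | e
    ... | refl , refl | refl = analysed-≡ (κᾱ-δˡ C D _) (κ-δˡ C (κ-ᾱ D kk))
    κᾱ∘atomic κ-id       (at-δʳ _ _ _) e = ⊥-elim (⊗≢⊙ (⊙-inj₂ e))
    κᾱ∘atomic (κ-ᾱ _ _)   (at-δʳ _ _ _) e = ⊥-elim (⊗≢⊙ (⊙-inj₂ e))
    κᾱ∘atomic (κ-ᾱ⁻¹ _ _) (at-δʳ _ _ _) e = ⊥-elim (⊗≢⊙ (⊙-inj₂ e))
    κᾱ∘atomic (κ-δˡ _ kk) (at-δʳ C D E) e with ⊙-inj e | ⊗-inj (⊙-inj₂ e) | e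
    ... | refl , _ | refl , refl | refl = analysed-≡ (κᾱκδˡ-δʳ C D _) (κ-δˡ (C ⊙₀ D) kk)
    κᾱ∘atomic (κ-δʳ _ kk) (at-δʳ C D E) e with ⊙-inj e | ⊗-inj (⊙-inj₂ e) | e
    ... | refl , _ | refl , refl | refl = kappa-≡ (κᾱκδʳ-δʳ C E _) (κ-δʳ E (κ-ᾱ C kk))
    κᾱ∘atomic kk (at-⊙ˡ {f = f} _ _) e with ⊙-inj e | e
    ... | refl , refl | refl = analysed-≡ (κᾱ-nat f _) (κ-ᾱ _ kk)
    κᾱ∘atomic kk (at-⊙ʳ {f = f} _ a) e with ⊙-inj e | e
    ... | refl , refl | refl =
      IdAnalysable-resp (κᾱ-∘ _ f) (IdAnalysable-κᾱ (kappa∘atomic kk a refl))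

    κᾱ⁻¹∘atomic _ (at-α _ _ _)   e = ⊥-elim (⊗≢⊙ e)
    κᾱ⁻¹∘atomic _ (at-α⁻¹ _ _ _) e = ⊥-elim (⊗≢⊙ e)
    κᾱ⁻¹∘atomic _ (at-⊗ˡ _ _)    e = ⊥-elim (⊗≢⊙ e)
    κᾱ⁻¹∘atomic _ (at-⊗ʳ _ _)    e = ⊥-elim (⊗≢⊙ e)
    κᾱ⁻¹∘atomic κ-id (at-ᾱ C D E) e with ⊙-inj e | ⊙-inj (⊙-inj₁ e) | e
    ... | _ , refl | refl , refl | refl = kappa-≡ (trans (cong (_∘ _) κᾱ⁻¹-id) (ᾱ-iso₂ C D E)) κ-id
    κᾱ⁻¹∘atomic (κ-ᾱ _ kk) (at-ᾱ C D E) e with ⊙-inj e | ⊙-inj (⊙-inj₁ e) | e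
    ... | _ , refl | refl , refl | refl = kappa-≡ (κᾱ⁻¹κᾱ-ᾱ C E _) (κ-ᾱ C (κ-ᾱ⁻¹ E kk))
    κᾱ⁻¹∘atomic (κ-ᾱ⁻¹ _ kk) (at-ᾱ C D E) e with ⊙-inj e | ⊙-inj (⊙-inj₁ e) | e
    ... | _ , refl | refl , refl | refl = analysed-≡ (κᾱ⁻¹κᾱ⁻¹-ᾱ D E _) (κ-ᾱ⁻¹ (D ⊙₀ E) kk)
    κᾱ⁻¹∘atomic (κ-δˡ _ _) (at-ᾱ _ _ _) e = ⊥-elim (⊙≢⊗ (⊙-inj₁ e))
    κᾱ⁻¹∘atomic (κ-δʳ _ _) (at-ᾱ _ _ _) e = ⊥-elim (⊙≢⊗ (⊙-inj₁ e))
    κᾱ⁻¹∘atomic kk (at-ᾱ⁻¹ C D E) e with ⊙-inj e | e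
    ... | refl , refl | refl = analysed-≡ (κᾱ⁻¹-ᾱ⁻¹ D E _) (κ-ᾱ⁻¹ E (κ-ᾱ⁻¹ D kk))
    κᾱ⁻¹∘atomic κ-id       (at-δˡ _ _ _) e = ⊥-elim (⊗≢⊙ (⊙-inj₁ e))
    κᾱ⁻¹∘atomic (κ-ᾱ _ _)   (at-δˡ _ _ _) e = ⊥-elim (⊗≢⊙ (⊙-inj₁ e))
    κᾱ⁻¹∘atomic (κ-ᾱ⁻¹ _ _) (at-δˡ _ _ _) e = ⊥-elim (⊗≢⊙ (⊙-inj₁ e))
    κᾱ⁻¹∘atomic (κ-δˡ _ kk) (at-δˡ C D E) e with ⊙-inj e | ⊗-inj (⊙-inj₁ e) | e
    ... | _ , refl | refl , refl | refl = kappa-≡ (κᾱ⁻¹κδˡ-δˡ C E _) (κ-δˡ C (κ-ᾱ⁻¹ E kk))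
    κᾱ⁻¹∘atomic (κ-δʳ _ kk) (at-δˡ C D E) e with ⊙-inj e | ⊗-inj (⊙-inj₁ e) | e
    ... | _ , refl | refl , refl | refl = analysed-≡ (κᾱ⁻¹κδʳ-δˡ D E _) (κ-δʳ (D ⊙₀ E) kk)
    κᾱ⁻¹∘atomic kk (at-δʳ C D E) e with ⊙-inj e | e
    ... | refl , refl | refl = analysed-≡ (κᾱ⁻¹-δʳ D E _) (κ-δʳ E (κ-ᾱ⁻¹ D kk))
    κᾱ⁻¹∘atomic kk (at-⊙ˡ {f = f} _ a) e with ⊙-inj e | e
    ... | refl , refl | refl =
      IdAnalysable-resp (κᾱ⁻¹-∘ _ f) (IdAnalysable-κᾱ⁻¹ (kappa∘atomic kk a refl))
    κᾱ⁻¹∘atomic kk (at-⊙ʳ {f = f} _ _) e with ⊙-inj e | e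
    ... | refl , refl | refl = analysed-≡ (κᾱ⁻¹-nat f _) (κ-ᾱ⁻¹ _ kk)

    κδˡ∘atomic _ (at-ᾱ _ _ _)   e = ⊥-elim (⊙≢⊗ e)
    κδˡ∘atomic _ (at-ᾱ⁻¹ _ _ _) e = ⊥-elim (⊙≢⊗ e)
    κδˡ∘atomic _ (at-δˡ _ _ _)  e = ⊥-elim (⊙≢⊗ e)
    κδˡ∘atomic _ (at-δʳ _ _ _)  e = ⊥-elim (⊙≢⊗ e)
    κδˡ∘atomic _ (at-⊙ˡ _ _)    e = ⊥-elim (⊙≢⊗ e)
    κδˡ∘atomic _ (at-⊙ʳ _ _)    e = ⊥-elim (⊙≢⊗ e)
    κδˡ∘atomic kk (at-α C D E) e with ⊗-inj e | e
    ... | refl , refl | refl = analysed-≡ (κδˡ-α C D _) (κ-δˡ C (κ-δˡ D kk))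
    κδˡ∘atomic κ-id       (at-α⁻¹ _ _ _) e = ⊥-elim (⊗≢⊙ (⊗-inj₂ e))
    κδˡ∘atomic (κ-ᾱ _ _)   (at-α⁻¹ _ _ _) e = ⊥-elim (⊗≢⊙ (⊗-inj₂ e))
    κδˡ∘atomic (κ-ᾱ⁻¹ _ _) (at-α⁻¹ _ _ _) e = ⊥-elim (⊗≢⊙ (⊗-inj₂ e))
    κδˡ∘atomic (κ-δˡ _ kk) (at-α⁻¹ C D E) e with ⊗-inj e | ⊗-inj (⊗-inj₂ e) | e
    ... | refl , _ | refl , refl | refl = analysed-≡ (κδˡκδˡ-α⁻¹ C D _) (κ-δˡ (C ⊗₀ D) kk)
    κδˡ∘atomic (κ-δʳ _ kk) (at-α⁻¹ C D E) e with ⊗-inj e | ⊗-inj (⊗-inj₂ e) | e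
    ... | refl , _ | refl , refl | refl = kappa-≡ (κδˡκδʳ-α⁻¹ C E _) (κ-δʳ E (κ-δˡ C kk))
    κδˡ∘atomic kk (at-⊗ˡ {f = f} _ _) e with ⊗-inj e | e
    ... | refl , refl | refl = analysed-≡ (κδˡ-nat f _) (κ-δˡ _ kk)
    κδˡ∘atomic kk (at-⊗ʳ {f = f} _ a) e with ⊗-inj e | e
    ... | refl , refl | refl =
      IdAnalysable-resp (κδˡ-∘ _ f) (IdAnalysable-κδˡ (kappa∘atomic kk a refl))

    κδʳ∘atomic _ (at-ᾱ _ _ _)   e = ⊥-elim (⊙≢⊗ e)
    κδʳ∘atomic _ (at-ᾱ⁻¹ _ _ _) e = ⊥-elim (⊙≢⊗ e)
    κδʳ∘atomic _ (at-δˡ _ _ _)  e = ⊥-elim (⊙≢⊗ e)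
    κδʳ∘atomic _ (at-δʳ _ _ _)  e = ⊥-elim (⊙≢⊗ e)
    κδʳ∘atomic _ (at-⊙ˡ _ _)    e = ⊥-elim (⊙≢⊗ e)
    κδʳ∘atomic _ (at-⊙ʳ _ _)    e = ⊥-elim (⊙≢⊗ e)
    κδʳ∘atomic κ-id       (at-α _ _ _) e = ⊥-elim (⊗≢⊙ (⊗-inj₁ e))
    κδʳ∘atomic (κ-ᾱ _ _)   (at-α _ _ _) e = ⊥-elim (⊗≢⊙ (⊗-inj₁ e))
    κδʳ∘atomic (κ-ᾱ⁻¹ _ _) (at-α _ _ _) e = ⊥-elim (⊗≢⊙ (⊗-inj₁ e))
    κδʳ∘atomic (κ-δˡ _ kk) (at-α C D E) e with ⊗-inj e | ⊗-inj (⊗-inj₁ e) | e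
    ... | _ , refl | refl , refl | refl = kappa-≡ (κδʳκδˡ-α C E _) (κ-δˡ C (κ-δʳ E kk))
    κδʳ∘atomic (κ-δʳ _ kk) (at-α C D E) e with ⊗-inj e | ⊗-inj (⊗-inj₁ e) | e
    ... | _ , refl | refl , refl | refl = analysed-≡ (κδʳκδʳ-α D E _) (κ-δʳ (D ⊗₀ E) kk)
    κδʳ∘atomic kk (at-α⁻¹ C D E) e with ⊗-inj e | e
    ... | refl , refl | refl = analysed-≡ (κδʳ-α⁻¹ D E _) (κ-δʳ E (κ-δʳ D kk))
    κδʳ∘atomic kk (at-⊗ˡ {f = f} _ a) e with ⊗-inj e | e
    ... | refl , refl | refl =
      IdAnalysable-resp (κδʳ-∘ _ f) (IdAnalysable-κδʳ (kappa∘atomic kk a refl))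
    κδʳ∘atomic kk (at-⊗ʳ {f = f} _ _) e with ⊗-inj e | e
    ... | refl , refl | refl = analysed-≡ (κδʳ-nat f _) (κ-δʳ _ kk)

lemma4p7 : ∀ {o h} (𝒞 : LDCat o h) → Tidy 𝒞 →
           (u : 𝔷) (As : Vec (LDCat.Obj 𝒞) (length u)) (L R : LDCat.Obj 𝒞) →
           ∀ {X} (hm : LDCat.Hom 𝒞 X (Hᶠ 𝒞 (LDCat._⊙₀_ 𝒞 L R) u As)) → Atomic 𝒞 hm →
           Analysable 𝒞 (Id⊙ 𝒞) (LDCat._∘_ 𝒞 (κ 𝒞 {LDCat._⊙₀_ 𝒞 L R} {L} {R} (LDCat.id 𝒞) u As) hm)
lemma4p7 𝒞 T u As L R hm atomic =
  IdAnalysable⇒Analysable 𝒞 (kappa∘atomic 𝒞 T (isKappa-κ 𝒞 u As) atomic refl)
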